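{- Let $k\ge4$ be even and $s,w$ integers of opposite parity with $1\le s,w\le k-1$. Then, as polynomials in $x$, $Z_{k-s,w}(1-x)=(-1)^{k/2}Z_{s,w}(x)$.
   Context: For integers $s,w$ of opposite parity with $1\le s,w\le k-1$, $Z_{s,w}(x)=(-1)^{(s+w+1)/2}\binom{k-2}{s-1}^{ -1}\sum_{r=0}^{k-1}(-x)^r\binom{k-1-w}{r}\binom{w-1+r}{k-1-s}$. -}

module Defs where

open import Data.Nat as ℕ using (ℕ; zero; suc; _∸_)
open import Data.Nat.Combinatorics using (_C_)
open import Data.Integer using (+_)
open import Data.Rational using (ℚ; _+_; _*_; _-_; -_; 0ℚ; 1ℚ; _/_)

ℕ→ℚ : ℕ → ℚ
ℕ→ℚ n = + n / 1

_^ℚ_ : ℚ → ℕ → ℚ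
p ^ℚ zero  = 1ℚ
p ^ℚ suc n = p * (p ^ℚ n)

sgn : ℕ → ℚ
sgn zero    = 1ℚ
sgn (suc n) = - sgn n

-- reciprocal of a natural number (convention 1/0 := 0, never used under the hypotheses)
inv : ℕ → ℚ
inv zero    = 0ℚ
inv (suc n) = + 1 / suc n

Σ< : ℕ → (ℕ → ℚ) → ℚ
Σ< zero    f = 0ℚ
Σ< (suc n) f = Σ< n f + f n

Z : (k s w : ℕ) → ℚ → ℚ
Z k s w x =
  sgn ((s ℕ.+ w ℕ.+ 1) ℕ./ 2) * inv ((k ∸ 2) C (s ∸ 1)) *
  Σ< k (λ r → ((- x) ^ℚ r) * ℕ→ℚ ((k ∸ 1 ∸ w) C r) * ℕ→ℚ ((w ∸ 1 ℕ.+ r) C (k ∸ 1 ∸ s)))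

-- Write y = -x and z = 1 - x = 1 + y.  With n = k-1-w, a = w-1, m = k-1-s the
-- sum in Z_{s,w}(x) is  S_y(a,n,m) = Σ_r y^r C(n,r) C(a+r,m), the coefficient of
-- t^m in  Σ_r C(n,r) y^r (1+t)^{a+r} = (1+t)^a (z + y t)^n.
-- Replacing x by 1-x swaps (y, z) with (-z, -y).  The coefficient sequence of
-- (1+t)^a (-y - z t)^n is (-1)^n times that of (1+t)^a (y + z t)^n, which in turn
-- is the reversal of that of (1+t)^a (z + y t)^n; and reversing the index m in
-- degree a + n = k-2 turns m' = s-1 into m = k-1-s.  So the two sums agree up to
-- (-1)^n; the normalising binomials agree by C(k-2,k-s-1) = C(k-2,s-1), and the
-- remaining signs combine to (-1)^{k/2} by a parity computation.

module Submission where

open import Defs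
open import Data.Nat using (ℕ; _≤_; _∸_; _/_; _%_; _+_)
open import Data.Rational using (ℚ; _*_; _-_; 1ℚ)
open import Relation.Binary.PropositionalEquality using (_≡_)

open import Data.Nat as ℕ using (zero; suc; _<_; s≤s)
import Data.Nat.Properties as ℕP
open import Data.Nat.Combinatorics using (_C_; nCk+nC[k+1]≡[n+1]C[k+1]; k>n⇒nCk≡0; nCk≡nC[n∸k])
open import Data.Nat.Divisibility using (_∣_; divides; m%n≡0⇒n∣m; n∣m*n; ∣m∣n⇒∣m+n; ∣m+n∣m⇒∣n)
open import Data.Nat.DivMod using (m≡m%n+[m/n]*n; m/n*n≡m)
open import Data.Nat.Tactic.RingSolver using () renaming (solve to ℕ-solve)
open import Data.List using ([]; _∷_)
open import Data.Integer as ℤ using (+_)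
import Data.Integer.Properties as ℤP
open import Data.Rational using (-_; 0ℚ; toℚᵘ) renaming (_+_ to _⊕_)
open import Data.Rational.Properties using (toℚᵘ-injective; toℚᵘ-fromℚᵘ; toℚᵘ-homo-+; *-identityˡ)
import Data.Rational.Unnormalised as U
import Data.Rational.Unnormalised.Properties as UP
open import Data.Rational.Solver using (module +-*-Solver)
open +-*-Solver
open import Relation.Binary.PropositionalEquality using (refl; sym; trans; cong; cong₂; subst; module ≡-Reasoning)

ℕ→ℚ-+ : ∀ m n → ℕ→ℚ (m + n) ≡ ℕ→ℚ m ⊕ ℕ→ℚ n
ℕ→ℚ-+ m n = toℚᵘ-injective (begin
    toℚᵘ (ℕ→ℚ (m + n))                 ≈⟨ toℚᵘ-fromℚᵘ (U.mkℚᵘ (+ (m + n)) 0) ⟩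
    U.mkℚᵘ (+ (m + n)) 0                ≈⟨ UP.≃-reflexive (cong (λ i → U.mkℚᵘ i 0) (sym
                                             (cong₂ ℤ._+_ (ℤP.*-identityʳ (+ m)) (ℤP.*-identityʳ (+ n))))) ⟩
    U.mkℚᵘ (+ m) 0 U.+ U.mkℚᵘ (+ n) 0   ≈⟨ UP.+-cong (UP.≃-sym (toℚᵘ-fromℚᵘ (U.mkℚᵘ (+ m) 0)))
                                                     (UP.≃-sym (toℚᵘ-fromℚᵘ (U.mkℚᵘ (+ n) 0))) ⟩
    toℚᵘ (ℕ→ℚ m) U.+ toℚᵘ (ℕ→ℚ n)      ≈⟨ UP.≃-sym (toℚᵘ-homo-+ (ℕ→ℚ m) (ℕ→ℚ n)) ⟩
    toℚᵘ (ℕ→ℚ m ⊕ ℕ→ℚ n)               ∎)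
  where open UP.≃-Reasoning

pascalℚ : ∀ p m → ℕ→ℚ (suc p C suc m) ≡ ℕ→ℚ (p C m) ⊕ ℕ→ℚ (p C suc m)
pascalℚ p m = trans (cong ℕ→ℚ (sym (nCk+nC[k+1]≡[n+1]C[k+1] p m))) (ℕ→ℚ-+ (p C m) (p C suc m))

Σ-ext : ∀ N {f g : ℕ → ℚ} → (∀ r → f r ≡ g r) → Σ< N f ≡ Σ< N g
Σ-ext zero    f≗g = refl
Σ-ext (suc N) f≗g = cong₂ _⊕_ (Σ-ext N f≗g) (f≗g N)

Σ-+ : ∀ N (f g : ℕ → ℚ) → Σ< N (λ r → f r ⊕ g r) ≡ Σ< N f ⊕ Σ< N g
Σ-+ zero    f g = refl
Σ-+ (suc N) f g = trans (cong (_⊕ (f N ⊕ g N)) (Σ-+ N f g))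
  (solve 4 (λ a b c d → (a :+ b) :+ (c :+ d) := (a :+ c) :+ (b :+ d)) refl (Σ< N f) (Σ< N g) (f N) (g N))

Σ-* : ∀ N (c : ℚ) (f : ℕ → ℚ) → Σ< N (λ r → c * f r) ≡ c * Σ< N f
Σ-* zero    c f = solve 1 (λ c → con 0ℚ := c :* con 0ℚ) refl c
Σ-* (suc N) c f = trans (cong (_⊕ (c * f N)) (Σ-* N c f))
  (solve 3 (λ c a b → c :* a :+ c :* b := c :* (a :+ b)) refl c (Σ< N f) (f N))

Σ-shift : ∀ N (f : ℕ → ℚ) → Σ< (suc N) f ≡ f 0 ⊕ Σ< N (λ r → f (suc r))
Σ-shift zero    f = solve 1 (λ a → con 0ℚ :+ a := a :+ con 0ℚ) refl (f 0)
Σ-shift (suc N) f = trans (cong (_⊕ f (suc N)) (Σ-shift N f))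
  (solve 3 (λ a b c → (a :+ b) :+ c := a :+ (b :+ c)) refl (f 0) (Σ< N (λ r → f (suc r))) (f (suc N)))

Σ-pad : ∀ {N M} (f : ℕ → ℚ) → N ≤ M → (∀ r → N ≤ r → f r ≡ 0ℚ) → Σ< M f ≡ Σ< N f
Σ-pad {N} {M} f N≤M f-vanish = trans (cong (λ t → Σ< t f) (sym (ℕP.m∸n+n≡m N≤M))) (go (M ∸ N))
  where
  go : ∀ d → Σ< (d + N) f ≡ Σ< N f
  go zero    = refl
  go (suc d) = trans (cong₂ _⊕_ (go d) (f-vanish (d + N) (ℕP.m≤n+m N d)))
    (solve 1 (λ a → a :+ con 0ℚ := a) refl (Σ< N f))

-- Coefficient sequences of polynomials in t over ℚ.
Poly : Set
Poly = ℕ → ℚ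

VanishesAbove : ℕ → Poly → Set
VanishesAbove D p = ∀ m → D < m → p m ≡ 0ℚ

one : Poly
one zero    = 1ℚ
one (suc m) = 0ℚ

-- Coefficients of (u + v t) · p(t).
linMul : ℚ → ℚ → Poly → Poly
linMul u v p zero    = u * p zero
linMul u v p (suc m) = u * p (suc m) ⊕ v * p m

linMul-cong : ∀ u v {p q : Poly} → (∀ m → p m ≡ q m) → ∀ m → linMul u v p m ≡ linMul u v q m
linMul-cong u v p≗q zero    = cong (u *_) (p≗q 0)
linMul-cong u v p≗q (suc m) = cong₂ (λ a b → u * a ⊕ v * b) (p≗q (suc m)) (p≗q m)

linMul-vanish : ∀ u v {D} {p : Poly} → VanishesAbove D p → VanishesAbove (suc D) (linMul u v p)
linMul-vanish u v {D} p-vanish (suc m) (s≤s D<m) =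
  trans (cong₂ (λ a b → u * a ⊕ v * b) (p-vanish (suc m) (ℕP.m<n⇒m<1+n D<m)) (p-vanish m D<m))
    (solve 2 (λ u v → u :* con 0ℚ :+ v :* con 0ℚ := con 0ℚ) refl u v)

linMul-scale : ∀ u v c (p : Poly) m → linMul u v (λ i → c * p i) m ≡ c * linMul u v p m
linMul-scale u v c p zero    = solve 3 (λ u c a → u :* (c :* a) := c :* (u :* a)) refl u c (p 0)
linMul-scale u v c p (suc m) =
  solve 5 (λ u v c a b → u :* (c :* a) :+ v :* (c :* b) := c :* (u :* a :+ v :* b)) refl u v c (p (suc m)) (p m)

linMul-negate : ∀ u v c (p : Poly) m → linMul (- u) (- v) (λ i → c * p i) m ≡ (- c) * linMul u v p m
linMul-negate u v c p zero    = solve 3 (λ u c a → (:- u) :* (c :* a) := (:- c) :* (u :* a)) refl u c (p 0)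
linMul-negate u v c p (suc m) =
  solve 5 (λ u v c a b → (:- u) :* (c :* a) :+ (:- v) :* (c :* b) := (:- c) :* (u :* a :+ v :* b)) refl u v c (p (suc m)) (p m)

linMul-reverse : ∀ u v {D} {p q : Poly} → VanishesAbove D p → VanishesAbove D q →
  (∀ i j → i + j ≡ D → p i ≡ q j) →
  ∀ i j → i + j ≡ suc D → linMul u v p i ≡ linMul v u q j
linMul-reverse u v {D} {p} {q} p-vanish q-vanish p≍q zero (suc j) refl =
  trans (cong (u *_) (p≍q 0 j refl))
    (trans (solve 3 (λ u v b → u :* b := v :* con 0ℚ :+ u :* b) refl u v (q j))
      (cong (λ a → v * a ⊕ u * q j) (sym (q-vanish (suc j) (ℕP.n<1+n j)))))
linMul-reverse u v {D} {p} {q} p-vanish q-vanish p≍q (suc i) zero i+0≡D =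
  trans (cong₂ (λ a b → u * a ⊕ v * b)
           (p-vanish (suc i) (s≤s (ℕP.≤-reflexive (sym i≡D))))
           (p≍q i 0 (trans (ℕP.+-identityʳ i) i≡D)))
    (solve 3 (λ u v b → u :* con 0ℚ :+ v :* b := v :* b) refl u v (q 0))
  where
  i≡D : i ≡ D
  i≡D = trans (sym (ℕP.+-identityʳ i)) (ℕP.suc-injective i+0≡D)
linMul-reverse u v {D} {p} {q} p-vanish q-vanish p≍q (suc i) (suc j) eq =
  trans (cong₂ (λ a b → u * a ⊕ v * b)
           (p≍q (suc i) j (trans (sym (ℕP.+-suc i j)) i+j+1≡D))
           (p≍q i (suc j) i+j+1≡D))
    (solve 4 (λ u v a b → u :* a :+ v :* b := v :* b :+ u :* a) refl u v (q j) (q (suc j)))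
  where
  i+j+1≡D : i + suc j ≡ D
  i+j+1≡D = ℕP.suc-injective eq

-- Coefficients of (1 + t)^a (z + y t)^n.
coeff : ℚ → ℚ → ℕ → ℕ → Poly
coeff y z zero    zero    = one
coeff y z zero    (suc n) = linMul z y (coeff y z zero n)
coeff y z (suc a) n       = linMul 1ℚ 1ℚ (coeff y z a n)

coeff-vanish : ∀ y z a n → VanishesAbove (a + n) (coeff y z a n)
coeff-vanish y z zero    zero    (suc m) _ = refl
coeff-vanish y z zero    (suc n) = linMul-vanish z y (coeff-vanish y z zero n)
coeff-vanish y z (suc a) n       = linMul-vanish 1ℚ 1ℚ (coeff-vanish y z a n)

coeff-negate : ∀ y z a n m → coeff (- y) (- z) a n m ≡ sgn n * coeff y z a n m
coeff-negate y z zero    zero    zero    = refl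
coeff-negate y z zero    zero    (suc m) = refl
coeff-negate y z zero    (suc n) m =
  trans (linMul-cong (- z) (- y) (coeff-negate y z zero n) m) (linMul-negate z y (sgn n) (coeff y z zero n) m)
coeff-negate y z (suc a) n       m =
  trans (linMul-cong 1ℚ 1ℚ (coeff-negate y z a n) m) (linMul-scale 1ℚ 1ℚ (sgn n) (coeff y z a n) m)

-- t^{a+n} (1 + 1/t)^a (z + y/t)^n = (1 + t)^a (y + z t)^n: coefficients reverse.
coeff-reverse : ∀ y z a n i j → i + j ≡ a + n → coeff y z a n i ≡ coeff z y a n j
coeff-reverse y z zero zero zero zero refl = refl
coeff-reverse y z zero (suc n) i j =
  linMul-reverse z y (coeff-vanish y z zero n) (coeff-vanish z y zero n) (coeff-reverse y z zero n) i j
coeff-reverse y z (suc a) n i j =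
  linMul-reverse 1ℚ 1ℚ (coeff-vanish y z a n) (coeff-vanish z y a n) (coeff-reverse y z a n) i j

binomTerm : ℚ → ℕ → ℕ → ℕ → ℕ → ℚ
binomTerm y a n m r = (y ^ℚ r) * ℕ→ℚ (n C r) * ℕ→ℚ ((a + r) C m)

binomSum : ℚ → ℕ → ℕ → ℕ → ℚ
binomSum y a n m = Σ< (suc n) (binomTerm y a n m)

binomTerm-vanish : ∀ y a n m r → suc n ≤ r → binomTerm y a n m r ≡ 0ℚ
binomTerm-vanish y a n m r n<r =
  trans (cong (λ t → (y ^ℚ r) * ℕ→ℚ t * ℕ→ℚ ((a + r) C m)) (k>n⇒nCk≡0 n<r))
    (solve 2 (λ a b → a :* con 0ℚ :* b := con 0ℚ) refl (y ^ℚ r) (ℕ→ℚ ((a + r) C m)))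

binomSum-pad : ∀ y a n m N → suc n ≤ N → Σ< N (binomTerm y a n m) ≡ binomSum y a n m
binomSum-pad y a n m N n<N = Σ-pad (binomTerm y a n m) n<N (binomTerm-vanish y a n m)

-- Pascal's rule on C(a+1+r, m): S satisfies the recursion of (1 + t) · _.
binomSum-step-a : ∀ y a n m → binomSum y (suc a) n m ≡ linMul 1ℚ 1ℚ (binomSum y a n) m
binomSum-step-a y a n zero    = sym (*-identityˡ (binomSum y a n 0))
binomSum-step-a y a n (suc m) = begin
    binomSum y (suc a) n (suc m)
  ≡⟨ Σ-ext (suc n) (λ r → cong (λ t → (y ^ℚ r) * ℕ→ℚ (n C r) * t) (pascalℚ (a + r) m)) ⟩
    Σ< (suc n) (λ r → (y ^ℚ r) * ℕ→ℚ (n C r) * (ℕ→ℚ ((a + r) C m) ⊕ ℕ→ℚ ((a + r) C suc m)))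
  ≡⟨ Σ-ext (suc n) (λ r → solve 3 (λ u p q → u :* (p :+ q) := u :* q :+ u :* p) refl
       ((y ^ℚ r) * ℕ→ℚ (n C r)) (ℕ→ℚ ((a + r) C m)) (ℕ→ℚ ((a + r) C suc m))) ⟩
    Σ< (suc n) (λ r → binomTerm y a n (suc m) r ⊕ binomTerm y a n m r)
  ≡⟨ Σ-+ (suc n) (binomTerm y a n (suc m)) (binomTerm y a n m) ⟩
    binomSum y a n (suc m) ⊕ binomSum y a n m
  ≡⟨ solve 2 (λ p q → p :+ q := con 1ℚ :* p :+ con 1ℚ :* q) refl (binomSum y a n (suc m)) (binomSum y a n m) ⟩
    linMul 1ℚ 1ℚ (binomSum y a n) (suc m)
  ∎
  where open ≡-Reasoning

-- Pascal's rule on C(n+1, r): S_y(0,n+1,m) = S_y(0,n,m) + y S_y(1,n,m).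
binomSum-split : ∀ y n m → binomSum y 0 (suc n) m ≡ binomSum y 0 n m ⊕ y * binomSum y 1 n m
binomSum-split y n m = begin
    binomSum y 0 (suc n) m
  ≡⟨ Σ-shift (suc n) (binomTerm y 0 (suc n) m) ⟩
    h 0 ⊕ Σ< (suc n) (λ r → binomTerm y 0 (suc n) m (suc r))
  ≡⟨ cong (h 0 ⊕_) (Σ-ext (suc n) shifted-term) ⟩
    h 0 ⊕ Σ< (suc n) (λ r → y * binomTerm y 1 n m r ⊕ h (suc r))
  ≡⟨ cong (h 0 ⊕_) (Σ-+ (suc n) (λ r → y * binomTerm y 1 n m r) (λ r → h (suc r))) ⟩
    h 0 ⊕ (Σ< (suc n) (λ r → y * binomTerm y 1 n m r) ⊕ Σ< (suc n) (λ r → h (suc r)))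
  ≡⟨ cong (λ t → h 0 ⊕ (t ⊕ Σ< (suc n) (λ r → h (suc r)))) (Σ-* (suc n) y (binomTerm y 1 n m)) ⟩
    h 0 ⊕ (y * binomSum y 1 n m ⊕ Σ< (suc n) (λ r → h (suc r)))
  ≡⟨ solve 3 (λ a b c → a :+ (b :+ c) := (a :+ c) :+ b) refl (h 0) (y * binomSum y 1 n m) (Σ< (suc n) (λ r → h (suc r))) ⟩
    (h 0 ⊕ Σ< (suc n) (λ r → h (suc r))) ⊕ y * binomSum y 1 n m
  ≡⟨ cong (_⊕ y * binomSum y 1 n m) (trans (sym (Σ-shift (suc n) h)) (binomSum-pad y 0 n m (suc (suc n)) (ℕP.n≤1+n (suc n)))) ⟩
    binomSum y 0 n m ⊕ y * binomSum y 1 n m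
  ∎
  where
  open ≡-Reasoning
  h : ℕ → ℚ
  h = binomTerm y 0 n m
  shifted-term : ∀ r → binomTerm y 0 (suc n) m (suc r) ≡ y * binomTerm y 1 n m r ⊕ h (suc r)
  shifted-term r = trans (cong (λ t → (y ^ℚ suc r) * t * ℕ→ℚ (suc r C m)) (pascalℚ n r))
    (solve 5 (λ y u p q v → y :* u :* (p :+ q) :* v := y :* (u :* p :* v) :+ y :* u :* q :* v) refl
      y (y ^ℚ r) (ℕ→ℚ (n C r)) (ℕ→ℚ (n C suc r)) (ℕ→ℚ (suc r C m)))

binomSum-step-n : ∀ y n m → binomSum y 0 (suc n) m ≡ linMul (1ℚ ⊕ y) y (binomSum y 0 n) m
binomSum-step-n y n zero = trans (binomSum-split y n 0)
  (solve 2 (λ y p → p :+ y :* p := (con 1ℚ :+ y) :* p) refl y (binomSum y 0 n 0))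
binomSum-step-n y n (suc m) = trans (binomSum-split y n (suc m))
  (trans (cong (λ t → binomSum y 0 n (suc m) ⊕ y * t) (binomSum-step-a y 0 n (suc m)))
    (solve 3 (λ y p q → p :+ y :* (con 1ℚ :* p :+ con 1ℚ :* q) := (con 1ℚ :+ y) :* p :+ y :* q) refl
      y (binomSum y 0 n (suc m)) (binomSum y 0 n m)))

binomSum≡coeff : ∀ y a n m → binomSum y a n m ≡ coeff y (1ℚ ⊕ y) a n m
binomSum≡coeff y zero    zero    zero    = refl
binomSum≡coeff y zero    zero    (suc m) = refl
binomSum≡coeff y zero    (suc n) m =
  trans (binomSum-step-n y n m) (linMul-cong (1ℚ ⊕ y) y (binomSum≡coeff y zero n) m)
binomSum≡coeff y (suc a) n       m =
  trans (binomSum-step-a y a n m) (linMul-cong 1ℚ 1ℚ (binomSum≡coeff y a n) m)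

binomSum-reflect : ∀ x a n i j → i + j ≡ a + n →
  binomSum (- (1ℚ - x)) a n i ≡ sgn n * binomSum (- x) a n j
binomSum-reflect x a n i j i+j≡a+n = begin
    binomSum (- z) a n i
  ≡⟨ binomSum≡coeff (- z) a n i ⟩
    coeff (- z) (1ℚ ⊕ - z) a n i
  ≡⟨ cong (λ t → coeff (- z) t a n i) (solve 1 (λ x → con 1ℚ :+ :- (con 1ℚ :- x) := :- (:- x)) refl x) ⟩
    coeff (- z) (- y) a n i
  ≡⟨ coeff-negate z y a n i ⟩
    sgn n * coeff z y a n i
  ≡⟨ cong (sgn n *_) (coeff-reverse z y a n i j i+j≡a+n) ⟩
    sgn n * coeff y z a n j
  ≡⟨ cong (sgn n *_) (sym (binomSum≡coeff y a n j)) ⟩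
    sgn n * binomSum y a n j
  ∎
  where
  open ≡-Reasoning
  y z : ℚ
  y = - x
  z = 1ℚ - x

sgn-+ : ∀ a b → sgn (a + b) ≡ sgn a * sgn b
sgn-+ zero    b = sym (*-identityˡ (sgn b))
sgn-+ (suc a) b = trans (cong -_ (sgn-+ a b)) (solve 2 (λ p q → :- (p :* q) := (:- p) :* q) refl (sgn a) (sgn b))

sgn-even : ∀ t → sgn (t ℕ.* 2) ≡ 1ℚ
sgn-even zero    = refl
sgn-even (suc t) = trans (solve 1 (λ p → :- (:- p) := p) refl (sgn (t ℕ.* 2))) (sgn-even t)

sgn-parity : ∀ {a b} c d → a + c ℕ.* 2 ≡ b + d ℕ.* 2 → sgn a ≡ sgn b
sgn-parity {a} {b} c d eq = begin
    sgn a                       ≡⟨ solve 1 (λ p → p := p :* con 1ℚ) refl (sgn a) ⟩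
    sgn a * 1ℚ                  ≡⟨ cong (sgn a *_) (sym (sgn-even c)) ⟩
    sgn a * sgn (c ℕ.* 2)       ≡⟨ sym (sgn-+ a (c ℕ.* 2)) ⟩
    sgn (a + c ℕ.* 2)           ≡⟨ cong sgn eq ⟩
    sgn (b + d ℕ.* 2)           ≡⟨ sgn-+ b (d ℕ.* 2) ⟩
    sgn b * sgn (d ℕ.* 2)       ≡⟨ cong (sgn b *_) (sgn-even d) ⟩
    sgn b * 1ℚ                  ≡⟨ solve 1 (λ p → p :* con 1ℚ := p) refl (sgn b) ⟩
    sgn b                       ∎
  where open ≡-Reasoning

odd⇒2∣suc : ∀ m → m % 2 ≡ 1 → 2 ∣ m + 1
odd⇒2∣suc m odd = divides (suc (m / 2)) (begin
    m + 1                     ≡⟨ cong (_+ 1) (m≡m%n+[m/n]*n m 2) ⟩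
    m % 2 + m / 2 ℕ.* 2 + 1   ≡⟨ cong (λ r → r + m / 2 ℕ.* 2 + 1) odd ⟩
    1 + m / 2 ℕ.* 2 + 1       ≡⟨ cong suc (ℕP.+-comm (m / 2 ℕ.* 2) 1) ⟩
    suc (m / 2) ℕ.* 2         ∎)
  where open ≡-Reasoning

halves-arith : ∀ {k d n s w} P K R → d + s ≡ k → n + w + 1 ≡ k →
  P ℕ.* 2 ≡ d + w + 1 → K ℕ.* 2 ≡ k → R ℕ.* 2 ≡ s + w + 1 → P + n + R ℕ.* 2 ≡ K + R + K ℕ.* 2
halves-arith {k} {d} {n} {s} {w} P K R hd hn hP hK hR = ℕP.*-cancelʳ-≡ _ _ 2 (begin
    (P + n + R ℕ.* 2) ℕ.* 2                              ≡⟨ ℕ-solve (P ∷ n ∷ R ∷ []) ⟩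
    P ℕ.* 2 + n ℕ.* 2 + R ℕ.* 2 ℕ.* 2                    ≡⟨ cong₂ (λ p r → p + n ℕ.* 2 + r ℕ.* 2) hP hR ⟩
    (d + w + 1) + n ℕ.* 2 + (s + w + 1) ℕ.* 2            ≡⟨ ℕ-solve (d ∷ w ∷ n ∷ s ∷ []) ⟩
    (d + s) + (n + w + 1) ℕ.* 2 + (s + w + 1)            ≡⟨ cong₂ (λ a b → a + b ℕ.* 2 + (s + w + 1)) hd hn ⟩
    k + k ℕ.* 2 + (s + w + 1)                            ≡⟨ cong₂ (λ a r → a + a ℕ.* 2 + r) (sym hK) (sym hR) ⟩
    K ℕ.* 2 + K ℕ.* 2 ℕ.* 2 + R ℕ.* 2                    ≡⟨ ℕ-solve (K ∷ R ∷ []) ⟩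
    (K + R + K ℕ.* 2) ℕ.* 2                              ∎)
  where open ≡-Reasoning

sgn-halves : ∀ {k d n s w} → d + s ≡ k → n + w + 1 ≡ k → 2 ∣ k → 2 ∣ s + w + 1 →
  sgn ((d + w + 1) / 2) * sgn n ≡ sgn (k / 2) * sgn ((s + w + 1) / 2)
sgn-halves {k} {d} {n} {s} {w} hd hn 2∣k 2∣s+w+1 = begin
    sgn P * sgn n   ≡⟨ sym (sgn-+ P n) ⟩
    sgn (P + n)     ≡⟨ sgn-parity {P + n} {K + R} R K (halves-arith P K R hd hn (m/n*n≡m 2∣d+w+1) (m/n*n≡m 2∣k) (m/n*n≡m 2∣s+w+1)) ⟩
    sgn (K + R)     ≡⟨ sgn-+ K R ⟩
    sgn K * sgn R   ∎
  where
  open ≡-Reasoning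
  P K R : ℕ
  P = (d + w + 1) / 2
  K = k / 2
  R = (s + w + 1) / 2
  -- d + w + 1 = k + (s + w + 1) - 2s is even because k and s + w + 1 are.
  2∣d+w+1 : 2 ∣ d + w + 1
  2∣d+w+1 = ∣m+n∣m⇒∣n (subst (2 ∣_) rearrange (∣m∣n⇒∣m+n 2∣k 2∣s+w+1)) (n∣m*n s)
    where
    rearrange : k + (s + w + 1) ≡ s ℕ.* 2 + (d + w + 1)
    rearrange = trans (cong (_+ (s + w + 1)) (sym hd)) (ℕ-solve (d ∷ s ∷ w ∷ []))

-- Both sums are S-sums with a = w-1, n = k-1-w (indices s-1 and
-- k-1-s respectively), related by the reflection formula; the binomial
-- normalisations agree by symmetry, and the signs by sgn-halves.
proposition4p4 : (k s w : ℕ) → k % 2 ≡ 0 → 4 ≤ k → (s + w) % 2 ≡ 1 →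
    1 ≤ s → s ≤ k ∸ 1 → 1 ≤ w → w ≤ k ∸ 1 →
    (x : ℚ) → Z k (k ∸ s) w (1ℚ - x) ≡ sgn (k / 2) * Z k s w x
proposition4p4 k@(suc (suc k')) s@(suc s₀) w@(suc w₀) k-even (s≤s (s≤s _)) s+w-odd _ (s≤s s₀≤k') _ (s≤s w₀≤k') x =
  begin
    sP * inv (k' C (d ∸ 1)) * Σ< k (binomTerm (- (1ℚ - x)) w₀ n i)
  ≡⟨ cong₂ (λ c t → sP * inv c * t) binom-symmetry reflected ⟩
    sP * I * (sgn n * S)
  ≡⟨ solve 4 (λ p q i t → p :* i :* (q :* t) := (p :* q) :* i :* t) refl sP (sgn n) I S ⟩
    (sP * sgn n) * I * S
  ≡⟨ cong (λ e → e * I * S) signs ⟩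
    (sgn (k / 2) * sR) * I * S
  ≡⟨ solve 4 (λ p q i t → (p :* q) :* i :* t := p :* (q :* i :* t)) refl (sgn (k / 2)) sR I S ⟩
    sgn (k / 2) * (sR * I * S)
  ∎
  where
  open ≡-Reasoning
  d n i j : ℕ
  d = suc k' ∸ s₀
  n = k' ∸ w₀
  i = suc k' ∸ d
  j = k' ∸ s₀
  sP sR I S : ℚ
  sP = sgn ((d + w + 1) / 2)
  sR = sgn ((s + w + 1) / 2)
  I  = inv (k' C s₀)
  S  = Σ< k (binomTerm (- x) w₀ n j)
  binom-symmetry : k' C (d ∸ 1) ≡ k' C s₀
  binom-symmetry = trans (cong (λ t → k' C (t ∸ 1)) (ℕP.+-∸-assoc 1 s₀≤k')) (sym (nCk≡nC[n∸k] s₀≤k'))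
  n<k : suc n ≤ k
  n<k = s≤s (ℕP.m≤n⇒m≤1+n (ℕP.m∸n≤m k' w₀))
  -- the two coefficient indices s-1 and k-1-s are mirror images in degree k-2
  i+j≡w₀+n : i + j ≡ w₀ + n
  i+j≡w₀+n = trans (cong (_+ j) (ℕP.m∸[m∸n]≡n (ℕP.m≤n⇒m≤1+n s₀≤k')))
    (trans (ℕP.m+[n∸m]≡n s₀≤k') (sym (ℕP.m+[n∸m]≡n w₀≤k')))
  reflected : Σ< k (binomTerm (- (1ℚ - x)) w₀ n i) ≡ sgn n * S
  reflected = trans (binomSum-pad (- (1ℚ - x)) w₀ n i k n<k)
    (trans (binomSum-reflect x w₀ n i j i+j≡w₀+n) (cong (sgn n *_) (sym (binomSum-pad (- x) w₀ n j k n<k))))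
  signs : sP * sgn n ≡ sgn (k / 2) * sR
  signs = sgn-halves {k} {d} {n} {s} {w}
    (ℕP.m∸n+n≡m (s≤s (ℕP.m≤n⇒m≤1+n s₀≤k')))
    (trans (ℕP.+-comm (n + w) 1) (cong suc (trans (ℕP.+-suc n w₀) (cong suc (ℕP.m∸n+n≡m w₀≤k')))))
    (m%n≡0⇒n∣m k 2 k-even) (odd⇒2∣suc (s + w) s+w-odd)
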